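{- Let $(G,\mathcal{P})$ be a grid-like graph. Then the collection $\mathcal{P}$ can be split as $\mathcal{P}=\mathcal{P}_1\cup\mathcal{P}_2$ such that each $\mathcal{P}_i$, $i=1,2$, consists of pairwise vertex-disjoint paths. Consequently, the maximum degree of $G$ is at most $4$.
   Context: A pair $(G,\mathcal{P})$, where $G$ is a simple graph and $\mathcal{P}$ a collection of paths, is grid-like if (i) $G$ is the union of all paths in $\mathcal{P}$, (ii) each path in $\mathcal{P}$ has at least two vertices, and (iii) the intersection graph $I(\mathcal{P})$ (vertices are the paths of $\mathcal{P}$, two adjacent iff they share a vertex) is bipartite. -}

module Defs where

open import Data.Nat using (ℕ; _≤_)
open import Data.Bool using (Bool; true; false)
open import Data.Fin using (Fin)
open import Data.List using (List; []; _∷_; _++_; length; filterᵇ; allFin)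
open import Data.List.Membership.Propositional using (_∈_)
open import Data.List.Relation.Unary.Unique.Propositional using (Unique)
open import Data.Product using (Σ; ∃; ∃-syntax; _×_)
open import Data.Sum using (_⊎_)
open import Relation.Nullary using (¬_)
open import Relation.Binary.PropositionalEquality using (_≡_; _≢_)

record SimpleGraph (n : ℕ) : Set where
  field
    adj     : Fin n → Fin n → Bool
    adj-sym : ∀ u v → adj u v ≡ adj v u
    adj-irr : ∀ v → adj v v ≡ false

open SimpleGraph public

degree : ∀ {n} → SimpleGraph n → Fin n → ℕ
degree G v = length (filterᵇ (adj G v) (allFin _))

MaxDegree≤ : ∀ {n} → SimpleGraph n → ℕ → Set
MaxDegree≤ G k = ∀ v → degree G v ≤ k

-- A path (as a vertex sequence) : pairwise distinct vertices.
-- Its edges are the pairs of consecutive vertices.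
IsPath : ∀ {n} → List (Fin n) → Set
IsPath p = Unique p

Consecutive : ∀ {n} → Fin n → Fin n → List (Fin n) → Set
Consecutive {n} u v p = ∃[ xs ] ∃[ ys ] (p ≡ xs ++ (u ∷ v ∷ ys))

PathEdge : ∀ {n} → List (Fin n) → Fin n → Fin n → Set
PathEdge p u v = Consecutive u v p ⊎ Consecutive v u p

ShareVertex : ∀ {n} → List (Fin n) → List (Fin n) → Set
ShareVertex p q = ∃[ v ] (v ∈ p × v ∈ q)

-- The collection of paths is indexed by Fin m.
-- Intersection graph I(P): i ~ j iff i ≢ j and P i, P j share a vertex.
-- It is bipartite iff it admits a proper 2-colouring.
IntersectionBipartite : ∀ {n m} → (Fin m → List (Fin n)) → Set
IntersectionBipartite {m = m} P =
  Σ (Fin m → Bool) λ c →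
    (i j : Fin m) → i ≢ j → ShareVertex (P i) (P j) → c i ≢ c j

record GridLike {n m : ℕ} (G : SimpleGraph n) (P : Fin m → List (Fin n)) : Set where
  field
    paths     : ∀ i → IsPath (P i)
    atLeast2  : ∀ i → 2 ≤ length (P i)
    covers    : ∀ v → ∃[ i ] (v ∈ P i)
    edges     : ∀ u v → adj G u v ≡ true → ∃[ i ] PathEdge (P i) u v
    edges⁻    : ∀ i u v → PathEdge (P i) u v → adj G u v ≡ true
    bipartite : IntersectionBipartite P

module Submission where

-- A proper 2-colouring c of the intersection graph I(P) is
-- already the required split: two distinct paths of the same colour are
-- non-adjacent in I(P), i.e. vertex-disjoint.  For the degree bound fix a
-- vertex v.  Within one colour class at most one path passes through v,
-- and along a duplicate-free path v has at most two neighbours (the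
-- vertices just before and just after it).  Every edge of G lies on some
-- path, so every neighbour of v is among these at most 2 + 2 vertices;
-- since the neighbours of v form a duplicate-free list, deg v ≤ 4.

open import Defs
open import Data.Nat using (ℕ; suc; _≤_; z≤n; s≤s)
open import Data.Nat.Properties using (≤-trans; ≤-reflexive; +-mono-≤; module ≤-Reasoning)
open import Data.Bool using (Bool; true; false; T?) renaming (_≟_ to _≟ᵇ_)
open import Data.Bool.Properties using (T-≡)
open import Data.Maybe using (Maybe; just; nothing)
open import Data.Fin using (Fin; _≟_)
open import Data.Fin.Properties using (any?)
open import Data.List using (List; []; _∷_; _++_; length; take; fromMaybe; filterᵇ; allFin)
open import Data.List.Properties using (length-++; length-++-sucʳ)
open import Data.List.Membership.Propositional using (_∈_)
open import Data.List.Membership.Propositional.Properties using (∈-++⁺ˡ; ∈-++⁺ʳ; ∈-++⁻; ∈-∃++; ∈-filter⁻)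
import Data.List.Membership.DecPropositional as DecMembership
open import Data.List.Relation.Unary.Any using (here; there)
open import Data.List.Relation.Unary.All as All using ()
open import Data.List.Relation.Unary.AllPairs using (_∷_)
open import Data.List.Relation.Unary.Unique.Propositional using (Unique)
open import Data.List.Relation.Unary.Unique.Propositional.Properties using (filter⁺; allFin⁺)
open import Data.Product using (Σ; ∃-syntax; _×_; _,_; proj₁; proj₂)
open import Data.Sum using (inj₁; inj₂)
open import Data.Empty using (⊥-elim)
open import Function using (_∘_)
open import Function.Bundles using (Equivalence)
open import Relation.Nullary using (¬_; Dec; yes; no)
open import Relation.Nullary.Decidable using (_×-dec_)
open import Relation.Binary.PropositionalEquality using (_≡_; _≢_; refl; sym; trans)

-- Pigeonhole for lists: a duplicate-free list contained in ys is no longer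
-- than ys.  This turns "all neighbours of v lie in a short list" into a
-- bound on the degree.
unique⊆⇒length≤ : {A : Set} {xs ys : List A} → Unique xs →
                  (∀ {x} → x ∈ xs → x ∈ ys) → length xs ≤ length ys
unique⊆⇒length≤ {xs = []} _ _ = z≤n
unique⊆⇒length≤ {xs = x ∷ xs} (x∉xs ∷ unique-xs) xs⊆ys with ∈-∃++ (xs⊆ys (here refl))
... | as , bs , refl = begin
  suc (length xs)          ≤⟨ s≤s (unique⊆⇒length≤ unique-xs xs⊆as++bs) ⟩
  suc (length (as ++ bs))  ≡⟨ sym (length-++-sucʳ as x bs) ⟩
  length (as ++ x ∷ bs)    ∎
  where
  open ≤-Reasoning
  -- removing x from ys keeps the other elements of xs, as x ∉ xs
  xs⊆as++bs : ∀ {y} → y ∈ xs → y ∈ as ++ bs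
  xs⊆as++bs {y} y∈xs with ∈-++⁻ as (xs⊆ys (there y∈xs))
  ... | inj₁ y∈as         = ∈-++⁺ˡ y∈as
  ... | inj₂ (here refl)  = ⊥-elim (All.lookup x∉xs y∈xs refl)
  ... | inj₂ (there y∈bs) = ∈-++⁺ʳ as y∈bs

module _ {n : ℕ} where

  around : Maybe (Fin n) → Fin n → List (Fin n) → List (Fin n)
  around prev v [] = []
  around prev v (x ∷ xs) with x ≟ v
  ... | yes _ = fromMaybe prev ++ take 1 xs
  ... | no  _ = around (just x) v xs

  pathNeighbours : List (Fin n) → Fin n → List (Fin n)
  pathNeighbours p v = around nothing v p

  pathNeighbours-length : ∀ p v → length (pathNeighbours p v) ≤ 2
  pathNeighbours-length p v = go nothing p
    where
    oneEachSide : ∀ (prev : Maybe (Fin n)) xs → length (fromMaybe prev ++ take 1 xs) ≤ 2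
    oneEachSide nothing  []      = z≤n
    oneEachSide nothing  (_ ∷ _) = s≤s z≤n
    oneEachSide (just _) []      = s≤s z≤n
    oneEachSide (just _) (_ ∷ _) = s≤s (s≤s z≤n)

    go : ∀ prev xs → length (around prev v xs) ≤ 2
    go prev [] = z≤n
    go prev (x ∷ xs) with x ≟ v
    ... | yes _ = oneEachSide prev xs
    ... | no  _ = go (just x) xs

  -- In a duplicate-free list, the head differs from every later element;
  -- this is why the scan never stops before the occurrence we look for.
  head≢ : ∀ {x y : Fin n} {xs} → Unique (x ∷ xs) → y ∈ xs → x ≢ y
  head≢ (x∉xs ∷ _) y∈xs = All.lookup x∉xs y∈xs

  around-successor : ∀ {v u ys} prev xs → Unique (xs ++ v ∷ u ∷ ys) →
                     u ∈ around prev v (xs ++ v ∷ u ∷ ys)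
  around-successor {v} prev [] _ with v ≟ v
  ... | yes _   = ∈-++⁺ʳ (fromMaybe prev) (here refl)
  ... | no  v≢v = ⊥-elim (v≢v refl)
  around-successor {v} prev (x ∷ xs) unique@(_ ∷ unique-xs) with x ≟ v
  ... | yes x≡v = ⊥-elim (head≢ unique (∈-++⁺ʳ xs (here refl)) x≡v)
  ... | no  _   = around-successor (just x) xs unique-xs

  -- The element preceding v is found; in the base case u ≢ v because u
  -- and v are distinct entries of a duplicate-free list.
  around-predecessor : ∀ {v u ys} prev xs → Unique (xs ++ u ∷ v ∷ ys) →
                       u ∈ around prev v (xs ++ u ∷ v ∷ ys)
  around-predecessor {v} {u} prev [] unique with u ≟ v
  ... | yes u≡v = ⊥-elim (head≢ unique (here refl) u≡v)
  ... | no  _ with v ≟ v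
  ...   | yes _   = here refl
  ...   | no  v≢v = ⊥-elim (v≢v refl)
  around-predecessor {v} prev (x ∷ xs) unique@(_ ∷ unique-xs) with x ≟ v
  ... | yes x≡v = ⊥-elim (head≢ unique (∈-++⁺ʳ xs (there (here refl))) x≡v)
  ... | no  _   = around-predecessor (just x) xs unique-xs

  pathNeighbours-complete : ∀ {p v u} → IsPath p → PathEdge p v u → u ∈ pathNeighbours p v
  pathNeighbours-complete unique (inj₁ (xs , _ , refl)) = around-successor nothing xs unique
  pathNeighbours-complete unique (inj₂ (xs , _ , refl)) = around-predecessor nothing xs unique

  pathEdge-∈ : ∀ {p : List (Fin n)} {v u} → PathEdge p v u → v ∈ p
  pathEdge-∈ (inj₁ (xs , _ , refl)) = ∈-++⁺ʳ xs (here refl)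
  pathEdge-∈ (inj₂ (xs , _ , refl)) = ∈-++⁺ʳ xs (there (here refl))

ColourClassesDisjoint : ∀ {n m} → (Fin m → List (Fin n)) → (Fin m → Bool) → Set
ColourClassesDisjoint P colour =
  ∀ i j → i ≢ j → colour i ≡ colour j → ¬ ShareVertex (P i) (P j)

bipartite⇒colourClassesDisjoint : ∀ {n m} {P : Fin m → List (Fin n)} →
  (bip : IntersectionBipartite P) → ColourClassesDisjoint P (proj₁ bip)
bipartite⇒colourClassesDisjoint (_ , proper) i j i≢j same shared = proper i j i≢j shared same

-- Neighbours of v along the paths of colour b: since these paths are
-- vertex-disjoint, at most one of them passes through v, and only its
-- (at most two) path neighbours count.
module ColourClass {n m} (P : Fin m → List (Fin n)) (colour : Fin m → Bool)
                   (v : Fin n) (b : Bool) where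

  open DecMembership (_≟_ {n}) using (_∈?_)

  ThroughV : Set
  ThroughV = ∃[ i ] (colour i ≡ b × v ∈ P i)

  throughV? : Dec ThroughV
  throughV? = any? λ i → (colour i ≟ᵇ b) ×-dec (v ∈? P i)

  classNeighbours : List (Fin n)
  classNeighbours with throughV?
  ... | yes (i , _) = pathNeighbours (P i) v
  ... | no  _       = []

  classNeighbours-length : length classNeighbours ≤ 2
  classNeighbours-length with throughV?
  ... | yes (i , _) = pathNeighbours-length (P i) v
  ... | no  _       = z≤n

  -- Every neighbour of v along a path of colour b is found: the path chosen
  -- by throughV? is that path, as otherwise two distinct paths of colour b
  -- would share v.
  classNeighbours-complete : (∀ i → IsPath (P i)) → ColourClassesDisjoint P colour →
    ∀ {j u} → colour j ≡ b → PathEdge (P j) v u → u ∈ classNeighbours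
  classNeighbours-complete paths disjoint {j} colour-j edge with throughV?
  ... | no nothingThroughV = ⊥-elim (nothingThroughV (j , colour-j , pathEdge-∈ edge))
  ... | yes (i , colour-i , v∈i) with i ≟ j
  ...   | yes refl = pathNeighbours-complete (paths i) edge
  ...   | no  i≢j  = ⊥-elim (disjoint i j i≢j (trans colour-i (sym colour-j)) (v , v∈i , pathEdge-∈ edge))

maxDegree≤4 : ∀ {n m} (G : SimpleGraph n) (P : Fin m → List (Fin n)) →
  (∀ i → IsPath (P i)) → (∀ u v → adj G u v ≡ true → ∃[ i ] PathEdge (P i) u v) →
  (colour : Fin m → Bool) → ColourClassesDisjoint P colour → MaxDegree≤ G 4
maxDegree≤4 {n} G P paths edges colour disjoint v =
  ≤-trans (unique⊆⇒length≤ neighbours-unique neighbours⊆candidates) candidates-length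
  where
  open ColourClass P colour v using (classNeighbours; classNeighbours-length; classNeighbours-complete)

  candidates : List (Fin n)
  candidates = classNeighbours true ++ classNeighbours false

  candidates-length : length candidates ≤ 4
  candidates-length = ≤-trans (≤-reflexive (length-++ (classNeighbours true)))
    (+-mono-≤ (classNeighbours-length true) (classNeighbours-length false))

  neighbours-unique : Unique (filterᵇ (adj G v) (allFin n))
  neighbours-unique = filter⁺ (T? ∘ adj G v) (allFin⁺ n)

  neighbour∈candidates : ∀ {u} → adj G v u ≡ true → u ∈ candidates
  neighbour∈candidates {u} v~u with edges v u v~u
  ... | j , edge with colour j in colour-j
  ... | true  = ∈-++⁺ˡ (classNeighbours-complete true paths disjoint colour-j edge)
  ... | false = ∈-++⁺ʳ (classNeighbours true) (classNeighbours-complete false paths disjoint colour-j edge)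

  neighbours⊆candidates : ∀ {u} → u ∈ filterᵇ (adj G v) (allFin n) → u ∈ candidates
  neighbours⊆candidates u∈ =
    neighbour∈candidates (Equivalence.to T-≡ (proj₂ (∈-filter⁻ (T? ∘ adj G v) {xs = allFin n} u∈)))

proposition14 : {n m : ℕ} (G : SimpleGraph n) (P : Fin m → List (Fin n)) →
    GridLike G P →
    (Σ (Fin m → Bool) λ part → ((i j : Fin m) → i ≢ j → part i ≡ part j →
        ¬ ShareVertex (P i) (P j)))
    × MaxDegree≤ G 4
proposition14 G P gridLike =
  (colour , disjoint) , maxDegree≤4 G P paths edges colour disjoint
  where
  open GridLike gridLike using (paths; edges; bipartite)
  colour = proj₁ bipartite
  disjoint = bipartite⇒colourClassesDisjoint bipartite
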